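{- Let $G$ be a simple cubic claw-free matching covered graph. Then every ridge of $G$ is nonremovable in $G$.
   Context: Matching covered: connected, at least two vertices, every edge in a perfect matching. Claw-free: no induced $K_{1,3}$. An edge $e$ is removable if $G-e$ is matching covered, nonremovable otherwise. A ridge is an edge lying in no triangle; by convention every edge of $K_4$ is a ridge. -}

module Defs where

open import Data.Nat using (ℕ; suc; _≤_)
open import Data.Fin using (Fin)
open import Data.List using (List; []; _∷_; length; filter; allFin)
open import Data.Product using (Σ; ∃; ∃-syntax; _×_; _,_)
open import Data.Sum using (_⊎_)
open import Relation.Nullary using (¬_; Dec)
open import Relation.Binary.PropositionalEquality using (_≡_; _≢_)

Rel : ℕ → Set₁
Rel n = Fin n → Fin n → Set

record Graph (n : ℕ) : Set₁ where
  field
    Adj   : Rel n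
    sym   : ∀ {x y} → Adj x y → Adj y x
    irref : ∀ x → ¬ Adj x x
    adj?  : ∀ x y → Dec (Adj x y)
open Graph public

data Walk {n : ℕ} (A : Rel n) : Fin n → Fin n → Set where
  here : ∀ {x} → Walk A x x
  step : ∀ {x y z} → A x y → Walk A y z → Walk A x z

Connected : {n : ℕ} → Rel n → Set
Connected A = ∀ x y → Walk A x y

-- A perfect matching given as its mate function: a fixed-point-free
-- involution pairing every vertex with a neighbour.
record PerfectMatching {n : ℕ} (A : Rel n) : Set where
  field
    mate     : Fin n → Fin n
    mate-adj : ∀ x → A x (mate x)
    mate-inv : ∀ x → mate (mate x) ≡ x

open PerfectMatching public

MatchingCovered : {n : ℕ} → Rel n → Set
MatchingCovered {n} A =
  Connected A × 2 ≤ n ×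
  (∀ x y → A x y → Σ (PerfectMatching A) λ M → mate M x ≡ y)

deleteEdge : {n : ℕ} → Rel n → Fin n → Fin n → Rel n
deleteEdge A u v x y = A x y × ¬ ((x ≡ u × y ≡ v) ⊎ (x ≡ v × y ≡ u))

Removable : {n : ℕ} → Graph n → Fin n → Fin n → Set
Removable G u v = MatchingCovered (deleteEdge (Adj G) u v)

Nonremovable : {n : ℕ} → Graph n → Fin n → Fin n → Set
Nonremovable G u v = ¬ Removable G u v

degree : {n : ℕ} → Graph n → Fin n → ℕ
degree {n} G v = length (filter (adj? G v) (allFin n))

Cubic : {n : ℕ} → Graph n → Set
Cubic {n} G = ∀ v → degree G v ≡ 3

ClawFree : {n : ℕ} → Graph n → Set
ClawFree {n} G = ∀ (c a b d : Fin n) →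
  ¬ ( Adj G c a × Adj G c b × Adj G c d
    × a ≢ b × a ≢ d × b ≢ d
    × ¬ Adj G a b × ¬ Adj G a d × ¬ Adj G b d )

IsK4 : {n : ℕ} → Graph n → Set
IsK4 {n} G = n ≡ 4 × (∀ x y → x ≢ y → Adj G x y)

-- A ridge: an edge in no triangle; by convention every edge of K4.
Ridge : {n : ℕ} → Graph n → Fin n → Fin n → Set
Ridge {n} G u v =
  Adj G u v × ((¬ (∃[ w ] (Adj G u w × Adj G v w))) ⊎ IsK4 G)

-- Let u have neighbours v, a, b.  Since uv lies in no triangle (or G is K4),
-- claw-freeness at u forces ab to be an edge.  If G - uv were matching
-- covered, ab would lie in a perfect matching of G - uv, and then u would
-- have no neighbour left to be matched to.
module Submission where

open import Defs
open import Data.Nat using (ℕ)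
open import Data.Fin using (Fin)
open import Data.List using (List; []; _∷_; length; filter; allFin)
open import Data.List.Membership.Propositional using (_∈_)
open import Data.List.Membership.Propositional.Properties using (∈-filter⁺; ∈-filter⁻; ∈-allFin)
open import Data.List.Relation.Unary.Any using (here; there)
open import Data.List.Relation.Unary.All using ([]; _∷_)
open import Data.List.Relation.Unary.AllPairs using ([]; _∷_)
open import Data.List.Relation.Unary.Unique.Propositional using (Unique)
import Data.List.Relation.Unary.Unique.Propositional.Properties as Unique
open import Data.Product using (_×_; _,_; proj₁; proj₂)
open import Data.Sum using (_⊎_; inj₁; inj₂; [_,_]′)
open import Data.Empty using (⊥-elim)
open import Function using (_∘_)
open import Relation.Nullary using (yes; no)
open import Relation.Binary.PropositionalEquality using (_≡_; _≢_; refl; trans) renaming (sym to ≡-sym)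

record TwoOthers {A : Set} (P : A → Set) (v : A) : Set where
  field
    a b   : A
    a≢b   : a ≢ b
    a≢v   : a ≢ v
    b≢v   : b ≢ v
    Pa    : P a
    Pb    : P b
    P⇒    : ∀ {x} → P x → x ≡ v ⊎ x ≡ a ⊎ x ≡ b

twoOthers-∈ : {A : Set} {xs : List A} {v : A} →
  Unique xs → length xs ≡ 3 → v ∈ xs → TwoOthers (_∈ xs) v
twoOthers-∈ {xs = p ∷ q ∷ r ∷ []} ((p≢q ∷ p≢r ∷ []) ∷ (q≢r ∷ []) ∷ [] ∷ []) _ v∈ = split v∈
  where
  split : ∀ {v} → v ∈ p ∷ q ∷ r ∷ [] → TwoOthers (_∈ p ∷ q ∷ r ∷ []) v
  split (here refl) = record
    { a = q ; b = r ; a≢b = q≢r ; a≢v = p≢q ∘ ≡-sym ; b≢v = p≢r ∘ ≡-sym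
    ; Pa = there (here refl) ; Pb = there (there (here refl))
    ; P⇒ = λ { (here e) → inj₁ e ; (there (here e)) → inj₂ (inj₁ e)
             ; (there (there (here e))) → inj₂ (inj₂ e) } }
  split (there (here refl)) = record
    { a = p ; b = r ; a≢b = p≢r ; a≢v = p≢q ; b≢v = q≢r ∘ ≡-sym
    ; Pa = here refl ; Pb = there (there (here refl))
    ; P⇒ = λ { (here e) → inj₂ (inj₁ e) ; (there (here e)) → inj₁ e
             ; (there (there (here e))) → inj₂ (inj₂ e) } }
  split (there (there (here refl))) = record
    { a = p ; b = q ; a≢b = p≢q ; a≢v = p≢r ; b≢v = q≢r
    ; Pa = here refl ; Pb = there (here refl)
    ; P⇒ = λ { (here e) → inj₂ (inj₁ e) ; (there (here e)) → inj₂ (inj₂ e)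
             ; (there (there (here e))) → inj₁ e } }

neighbours : {n : ℕ} → Graph n → Fin n → List (Fin n)
neighbours {n} G u = filter (adj? G u) (allFin n)

∈-neighbours⁺ : {n : ℕ} (G : Graph n) {u x : Fin n} → Adj G u x → x ∈ neighbours G u
∈-neighbours⁺ {n} G {x = x} = ∈-filter⁺ (adj? G _) {xs = allFin n} (∈-allFin x)

∈-neighbours⁻ : {n : ℕ} (G : Graph n) {u x : Fin n} → x ∈ neighbours G u → Adj G u x
∈-neighbours⁻ {n} G = proj₂ ∘ ∈-filter⁻ (adj? G _) {xs = allFin n}

neighbours-unique : {n : ℕ} (G : Graph n) (u : Fin n) → Unique (neighbours G u)
neighbours-unique {n} G u = Unique.filter⁺ (adj? G u) (Unique.allFin⁺ n)

otherNeighbours : {n : ℕ} (G : Graph n) {u v : Fin n} →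
  degree G u ≡ 3 → Adj G u v → TwoOthers (Adj G u) v
otherNeighbours G {u} deg3 uv = record
  { a = a ; b = b ; a≢b = a≢b ; a≢v = a≢v ; b≢v = b≢v
  ; Pa = ∈-neighbours⁻ G Pa ; Pb = ∈-neighbours⁻ G Pb
  ; P⇒ = P⇒ ∘ ∈-neighbours⁺ G }
  where open TwoOthers (twoOthers-∈ (neighbours-unique G u) deg3 (∈-neighbours⁺ G uv))

ridge-otherNeighbours-adjacent : {n : ℕ} (G : Graph n) → ClawFree G →
  ∀ {u v} → Ridge G u v → (N : TwoOthers (Adj G u) v) →
  Adj G (TwoOthers.a N) (TwoOthers.b N)
ridge-otherNeighbours-adjacent G _ (_ , inj₂ (_ , complete)) N =
  complete (TwoOthers.a N) (TwoOthers.b N) (TwoOthers.a≢b N)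
ridge-otherNeighbours-adjacent G clawFree {u} {v} (uv , inj₁ noTriangle) N
  with adj? G (TwoOthers.a N) (TwoOthers.b N)
... | yes ab = ab
... | no ¬ab = ⊥-elim (clawFree u v a b
  ( uv , Pa , Pb , a≢v ∘ ≡-sym , b≢v ∘ ≡-sym , a≢b
  , (λ va → noTriangle (a , Pa , va)) , (λ vb → noTriangle (b , Pb , vb)) , ¬ab ))
  where open TwoOthers N

adj⇒≢ : {n : ℕ} (G : Graph n) {x y : Fin n} → Adj G x y → x ≢ y
adj⇒≢ G {x} xy refl = irref G x xy

deleteEdge-keeps : {n : ℕ} {A : Rel n} {u v x y : Fin n} →
  A x y → x ≢ v → y ≢ v → deleteEdge A u v x y
deleteEdge-keeps xy x≢v y≢v = xy , λ
  { (inj₁ (_ , y≡v)) → y≢v y≡v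
  ; (inj₂ (x≡v , _)) → x≢v x≡v }

deleteEdge-deletes : {n : ℕ} {A : Rel n} {u v y : Fin n} →
  deleteEdge A u v u y → y ≢ v
deleteEdge-deletes (_ , notDeleted) y≡v = notDeleted (inj₁ (refl , y≡v))

mate-sym : {n : ℕ} {A : Rel n} (M : PerfectMatching A) {x y : Fin n} →
  mate M x ≡ y → mate M y ≡ x
mate-sym M {x} refl = mate-inv M x

mate-outside-pair : {n : ℕ} {A : Rel n} (M : PerfectMatching A) {a b u : Fin n} →
  mate M a ≡ b → u ≢ a → u ≢ b → mate M u ≢ a × mate M u ≢ b
mate-outside-pair M mate-a≡b u≢a u≢b =
    (λ mate-u≡a → u≢b (trans (≡-sym (mate-sym M mate-u≡a)) mate-a≡b))
  , (λ mate-u≡b → u≢a (trans (≡-sym (mate-sym M mate-u≡b)) (mate-sym M mate-a≡b)))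

perfectMatching-through-otherNeighbours-impossible :
  {n : ℕ} (G : Graph n) {u v : Fin n} (N : TwoOthers (Adj G u) v) →
  (M : PerfectMatching (deleteEdge (Adj G) u v)) →
  mate M (TwoOthers.a N) ≢ TwoOthers.b N
perfectMatching-through-otherNeighbours-impossible G {u} {v} N M mate-a≡b =
  [ deleteEdge-deletes {A = Adj G} u-m , [ m≢a , m≢b ]′ ]′ (P⇒ (proj₁ u-m))
  where
  open TwoOthers N
  u-m : deleteEdge (Adj G) u v u (mate M u)
  u-m = mate-adj M u
  m≢a : mate M u ≢ a
  m≢a = proj₁ (mate-outside-pair M mate-a≡b (adj⇒≢ G Pa) (adj⇒≢ G Pb))
  m≢b : mate M u ≢ b
  m≢b = proj₂ (mate-outside-pair M mate-a≡b (adj⇒≢ G Pa) (adj⇒≢ G Pb))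

lemma4p1 : {n : ℕ} (G : Graph n) → Cubic G → ClawFree G →
    MatchingCovered (Adj G) →
    ∀ (u v : Fin n) → Ridge G u v → Nonremovable G u v
lemma4p1 G cubic clawFree _ u v ridge@(uv , _) (_ , _ , inPerfectMatching) =
  perfectMatching-through-otherNeighbours-impossible G N M mate-a≡b
  where
  N : TwoOthers (Adj G u) v
  N = otherNeighbours G (cubic u) uv
  open TwoOthers N
  ab : deleteEdge (Adj G) u v a b
  ab = deleteEdge-keeps {A = Adj G} (ridge-otherNeighbours-adjacent G clawFree ridge N) a≢v b≢v
  M : PerfectMatching (deleteEdge (Adj G) u v)
  M = proj₁ (inPerfectMatching a b ab)
  mate-a≡b : mate M a ≡ b
  mate-a≡b = proj₂ (inPerfectMatching a b ab)
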